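{- Let $n \geq 6$ be an even integer, $p$ an odd prime and $k \geq 2$ an integer. Suppose that $\phi(p^k) < \lceil \log_2 n \rceil$, that $p^k$ divides $n$, and that $2$ is a primitive root modulo $p^k$. Then $\gamma(KG_n) \leq \frac{2n}{p^k}$.
   Context: $\phi$ denotes Euler's totient function. For even $n \geq 6$, the Knödel graph $KG_n$ has vertex set $\{0,1,\dots,n-1\}$, and $\{x,y\}$ is an edge if and only if $x + y \equiv 2^t - 1 \pmod n$ for some $t \in \{1,2,\dots,\lfloor \log_2 n\rfloor\}$. A dominating set of a graph $G$ is a set $D$ of vertices such that every vertex is in $D$ or adjacent to a vertex of $D$; $\gamma(G)$ denotes the minimum size of a dominating set. -}

module Defs where

open import Data.Nat using (ℕ; zero; suc; _+_; _*_; _∸_; _^_; _≤_; _<_; NonZero)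
open import Data.Nat.DivMod using (_%_; _/_)
open import Data.Nat.GCD using (gcd)
open import Data.Nat.Logarithm using (⌊log₂_⌋)
open import Data.List using (List; length; filter; upTo; map)
open import Data.Fin using (Fin; toℕ)
open import Data.Fin.Subset using (Subset; _∈_; ∣_∣)
open import Data.Product using (Σ; ∃; _×_)
open import Data.Sum using (_⊎_)
open import Relation.Nullary using (¬_)
open import Relation.Binary.PropositionalEquality using (_≡_)
import Data.Nat as ℕ

φ : ℕ → ℕ
φ m = length (filter (λ i → gcd i m ℕ.≟ 1) (map suc (upTo m)))

PrimitiveRoot2 : (m : ℕ) → .{{NonZero m}} → Set
PrimitiveRoot2 m =
  ((2 ^ φ m) % m ≡ 1 % m) ×
  (∀ j → 1 ≤ j → j < φ m → ¬ ((2 ^ j) % m ≡ 1 % m))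

KGAdj : (n : ℕ) → .{{NonZero n}} → Fin n → Fin n → Set
KGAdj n x y = ∃ λ t → (1 ≤ t) × (t ≤ ⌊log₂ n ⌋) ×
  ((toℕ x + toℕ y) % n ≡ (2 ^ t ∸ 1) % n)

IsDominatingKG : (n : ℕ) → .{{NonZero n}} → Subset n → Set
IsDominatingKG n D = ∀ (v : Fin n) → (v ∈ D) ⊎ (∃ λ u → (u ∈ D) × KGAdj n v u)

γKG≤ : (n : ℕ) → .{{NonZero n}} → ℕ → Set
γKG≤ n b = ∃ λ (D : Subset n) → IsDominatingKG n D × (∣ D ∣ ≤ b)

-- Let q = p ^ k and D the set of vertices congruent to 0 or 1 modulo q, so |D| = 2n/q as q ∣ n.
-- For a vertex v, one of v + 1, v + 2, say v + 1 + c, is prime to p and hence a unit modulo q.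
-- Since 2 is a primitive root, v + 1 + c ≡ 2 ^ t (mod q) for some 1 ≤ t ≤ φ(q) < ⌈log₂ n⌉, so
-- t ≤ ⌊log₂ n⌋ and the vertex u ≡ 2 ^ t − 1 − v (mod n) is a neighbour of v. As q ∣ n, reducing
-- u + v ≡ 2 ^ t − 1 modulo q gives u ≡ c (mod q), i.e. u ∈ D.
module Submission where

open import Defs
open import Data.Bool using (Bool; true; false)
open import Data.Bool.Properties using (T-≡)
open import Data.Empty using (⊥-elim)
open import Data.Fin using (Fin; zero; suc; toℕ; fromℕ<)
import Data.Fin as Fin
open import Data.Fin.Properties using (toℕ<n; toℕ-fromℕ<; pigeonhole)
open import Data.Fin.Subset using (Subset; ∣_∣)
import Data.Fin.Subset as Subset
open import Data.List using (List; filter; map; upTo; lookup)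
open import Data.List.Membership.Propositional using (_∈_)
open import Data.List.Membership.Propositional.Properties using (∈-filter⁺; ∈-map⁺; ∈-upTo⁺)
open import Data.List.Relation.Unary.Any using (index)
open import Data.List.Relation.Unary.Any.Properties using (lookup-index)
open import Data.Nat using (ℕ; zero; suc; pred; _+_; _*_; _∸_; _^_; _≤_; _<_; _<ᵇ_; _≟_; z≤n; s≤s; NonZero; nonTrivial⇒n>1)
open import Data.Nat.Coprimality using (gcd≡1⇒coprime; coprime-divisor)
open import Data.Nat.DivMod
open import Data.Nat.Divisibility
open import Data.Nat.GCD using (gcd; gcd-identityˡ; gcd[m,n]∣m; gcd[m,n]∣n)
open import Data.Nat.Logarithm using (⌊log₂_⌋; ⌈log₂_⌉; ⌊log₂⌋-mono-≤; ⌊log₂[2^n]⌋≡n; ⌈log₂⌉-mono-≤; ⌈log₂2^n⌉≡n)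
open import Data.Nat.Primality using (Prime; Irreducible; prime⇒irreducible; prime⇒nonZero; prime⇒nonTrivial; ¬prime[1])
open import Data.Nat.Properties
open import Data.Product using (∃; _×_; _,_)
open import Data.Sum using (_⊎_; inj₁; inj₂)
open import Data.Vec using (tabulate)
open import Data.Vec.Properties using (lookup∘tabulate; lookup⇒[]=)
open import Function using (_∘_; Equivalence)
open import Relation.Binary.PropositionalEquality
open import Relation.Nullary using (¬_; yes; no)

module ModularArithmetic (q : ℕ) .{{_ : NonZero q}} where

  %-congˡ-+ : ∀ c {a b} → a % q ≡ b % q → (c + a) % q ≡ (c + b) % q
  %-congˡ-+ c {a} {b} a≡b = begin
    (c + a) % q             ≡⟨ %-distribˡ-+ c a q ⟩
    (c % q + a % q) % q     ≡⟨ cong (λ x → (c % q + x) % q) a≡b ⟩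
    (c % q + b % q) % q     ≡⟨ %-distribˡ-+ c b q ⟨
    (c + b) % q             ∎
    where open ≡-Reasoning

  %-congʳ-* : ∀ c {a b} → a % q ≡ b % q → (a * c) % q ≡ (b * c) % q
  %-congʳ-* c {a} {b} a≡b = begin
    (a * c) % q             ≡⟨ %-distribˡ-* a c q ⟩
    (a % q * (c % q)) % q   ≡⟨ cong (λ x → (x * (c % q)) % q) a≡b ⟩
    (b % q * (c % q)) % q   ≡⟨ %-distribˡ-* b c q ⟨
    (b * c) % q             ∎
    where open ≡-Reasoning

  -- Adding pred q * c turns c into the multiple q * c.
  %-cancelˡ-+ : ∀ c {a b} → (c + a) % q ≡ (c + b) % q → a % q ≡ b % q
  %-cancelˡ-+ c {a} {b} c+a≡c+b = begin
    a % q                     ≡⟨ shift a ⟩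
    (k + (c + a)) % q         ≡⟨ %-congˡ-+ k c+a≡c+b ⟩
    (k + (c + b)) % q         ≡⟨ shift b ⟨
    b % q                     ∎
    where
    open ≡-Reasoning
    k = pred q * c
    q∣k+c : q ∣ k + c
    q∣k+c = subst (q ∣_) (+-comm c k)
              (subst (λ m → q ∣ m * c) (sym (suc-pred q)) (m∣m*n c))
    shift : ∀ x → x % q ≡ (k + (c + x)) % q
    shift x = trans (sym (%-remove-+ˡ x q∣k+c)) (cong (_% q) (+-assoc k c x))

  %-cong-∣ : ∀ {n} .{{_ : NonZero n}} {a b} → q ∣ n → a % n ≡ b % n → a % q ≡ b % q
  %-cong-∣ {n} {a} {b} q∣n a≡b = begin
    a % q       ≡⟨ m∣n⇒o%n%m≡o%m q n a q∣n ⟨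
    a % n % q   ≡⟨ cong (_% q) a≡b ⟩
    b % n % q   ≡⟨ m∣n⇒o%n%m≡o%m q n b q∣n ⟩
    b % q       ∎
    where open ≡-Reasoning

countBelow : (ℕ → Bool) → ℕ → ℕ
countBelow f n = ∣ tabulate {n = n} (f ∘ toℕ) ∣

countBelow-cong : ∀ {f g} n → (∀ {i} → i < n → f i ≡ g i) → countBelow f n ≡ countBelow g n
countBelow-cong {f} {g} zero f≗g = refl
countBelow-cong {f} {g} (suc n) f≗g
  rewrite f≗g {0} (s≤s z≤n) with g 0
... | true  = cong suc (countBelow-cong n (f≗g ∘ s≤s))
... | false = countBelow-cong n (f≗g ∘ s≤s)

countBelow-+ : ∀ f a b → countBelow f (a + b) ≡ countBelow f a + countBelow (f ∘ (a +_)) b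
countBelow-+ f zero b = refl
countBelow-+ f (suc a) b with f 0
... | true  = cong suc (countBelow-+ (f ∘ suc) a b)
... | false = countBelow-+ (f ∘ suc) a b

countBelow-periodic : ∀ f q m → (∀ i → f (q + i) ≡ f i) →
                      countBelow f (m * q) ≡ m * countBelow f q
countBelow-periodic f q zero periodic = refl
countBelow-periodic f q (suc m) periodic = begin
  countBelow f (q + m * q)                          ≡⟨ countBelow-+ f q (m * q) ⟩
  countBelow f q + countBelow (f ∘ (q +_)) (m * q)  ≡⟨ cong (countBelow f q +_) (countBelow-cong (m * q) (λ {i} _ → periodic i)) ⟩
  countBelow f q + countBelow f (m * q)             ≡⟨ cong (countBelow f q +_) (countBelow-periodic f q m periodic) ⟩
  countBelow f q + m * countBelow f q               ∎
  where open ≡-Reasoning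

countBelow-false : ∀ n → countBelow (λ _ → false) n ≡ 0
countBelow-false zero = refl
countBelow-false (suc n) = countBelow-false n

countBelow-<ᵇ2 : ∀ n → countBelow (_<ᵇ 2) n ≤ 2
countBelow-<ᵇ2 0 = z≤n
countBelow-<ᵇ2 1 = s≤s z≤n
countBelow-<ᵇ2 (suc (suc n)) = ≤-reflexive (cong (2 +_) (countBelow-false n))

units : ℕ → List ℕ
units q = filter (λ i → gcd i q ≟ 1) (map suc (upTo q))

∈-units : ∀ {q w} → 1 < q → w < q → gcd w q ≡ 1 → w ∈ units q
∈-units {q} {zero}  1<q _   gcd≡1 = ⊥-elim (<⇒≢ 1<q (trans (sym gcd≡1) (gcd-identityˡ q)))
∈-units {q} {suc w} _   w<q gcd≡1 =
  ∈-filter⁺ (λ i → gcd i q ≟ 1) (∈-map⁺ suc (∈-upTo⁺ (<⇒≤ w<q))) gcd≡1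

module PrimitiveRoot (q a : ℕ) .{{_ : NonZero q}} (1<q : 1 < q)
  (a^φ≡1 : a ^ φ q % q ≡ 1 % q)
  (order : ∀ j → 1 ≤ j → j < φ q → ¬ (a ^ j % q ≡ 1 % q)) where

  open ModularArithmetic q

  -- A common divisor of a ^ t mod q and q divides a ^ φ q ≡ 1 + (multiple of q), hence 1.
  ^%-coprime : ∀ t → t ≤ φ q → gcd (a ^ t % q) q ≡ 1
  ^%-coprime t t≤φ = ∣1⇒≡1 (∣m+n∣m⇒∣n g∣[a^φ/q]q+1 (∣n⇒∣m*n (a ^ φ q / q) g∣q))
    where
    g = gcd (a ^ t % q) q
    g∣q : g ∣ q
    g∣q = gcd[m,n]∣n (a ^ t % q) q
    g∣a^φ : g ∣ a ^ φ q
    g∣a^φ = subst (g ∣_) (trans (sym (^-distribˡ-+-* a t (φ q ∸ t))) (cong (a ^_) (m+[n∸m]≡n t≤φ)))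
              (∣m⇒∣m*n (a ^ (φ q ∸ t)) (∣n∣m%n⇒∣m g∣q (gcd[m,n]∣m (a ^ t % q) q)))
    a^φ≡[a^φ/q]q+1 : a ^ φ q ≡ (a ^ φ q / q) * q + 1
    a^φ≡[a^φ/q]q+1 = begin
      a ^ φ q                            ≡⟨ m≡m%n+[m/n]*n (a ^ φ q) q ⟩
      a ^ φ q % q + (a ^ φ q / q) * q    ≡⟨ cong (_+ (a ^ φ q / q) * q) (trans a^φ≡1 (m<n⇒m%n≡m 1<q)) ⟩
      1 + (a ^ φ q / q) * q              ≡⟨ +-comm 1 _ ⟩
      (a ^ φ q / q) * q + 1              ∎
      where open ≡-Reasoning
    g∣[a^φ/q]q+1 : g ∣ (a ^ φ q / q) * q + 1
    g∣[a^φ/q]q+1 = subst (g ∣_) a^φ≡[a^φ/q]q+1 g∣a^φ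

  -- Multiplying by a ^ (φ q ∸ j) would turn the congruence into a ^ e ≡ 1 with 1 ≤ e < φ q.
  ^%-injective : ∀ {i j} → 1 ≤ i → i < j → j ≤ φ q → a ^ i % q ≢ a ^ j % q
  ^%-injective {i} {j} 1≤i i<j j≤φ a^i≡a^j = order e (≤-trans 1≤i (m≤m+n i s)) e<φ a^e≡1
    where
    s = φ q ∸ j
    e = i + s
    e<φ : e < φ q
    e<φ = subst (e <_) (m+[n∸m]≡n j≤φ) (+-monoˡ-< s i<j)
    a^e≡1 : a ^ e % q ≡ 1 % q
    a^e≡1 = begin
      a ^ (i + s) % q        ≡⟨ cong (_% q) (^-distribˡ-+-* a i s) ⟩
      a ^ i * a ^ s % q      ≡⟨ %-congʳ-* (a ^ s) a^i≡a^j ⟩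
      a ^ j * a ^ s % q      ≡⟨ cong (_% q) (^-distribˡ-+-* a j s) ⟨
      a ^ (j + s) % q        ≡⟨ cong (λ m → a ^ m % q) (m+[n∸m]≡n j≤φ) ⟩
      a ^ φ q % q            ≡⟨ a^φ≡1 ⟩
      1 % q                  ∎
      where open ≡-Reasoning

  -- Pigeonhole on w, a ^ 1 mod q, …, a ^ φ q mod q: these φ q + 1 units of the list
  -- of length φ q cannot be distinct, and the powers among them are.
  discreteLog : ∀ w → w < q → gcd w q ≡ 1 → ∃ λ t → 1 ≤ t × t ≤ φ q × w ≡ a ^ t % q
  discreteLog w w<q w-coprime = fromCollision (pigeonhole (n<1+n (φ q)) (index ∘ candidate-unit))
    where
    candidate : Fin (suc (φ q)) → ℕ
    candidate zero    = w
    candidate (suc i) = a ^ suc (toℕ i) % q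
    candidate-unit : ∀ i → candidate i ∈ units q
    candidate-unit zero    = ∈-units 1<q w<q w-coprime
    candidate-unit (suc i) = ∈-units 1<q (m%n<n _ q) (^%-coprime (suc (toℕ i)) (toℕ<n i))
    collide : ∀ i j → index (candidate-unit i) ≡ index (candidate-unit j) → candidate i ≡ candidate j
    collide i j same = trans (lookup-index (candidate-unit i))
                         (trans (cong (lookup (units q)) same) (sym (lookup-index (candidate-unit j))))
    fromCollision : (∃ λ i → ∃ λ j → i Fin.< j × index (candidate-unit i) ≡ index (candidate-unit j)) →
                    ∃ λ t → 1 ≤ t × t ≤ φ q × w ≡ a ^ t % q
    fromCollision (zero  , suc j , _       , same) =
      suc (toℕ j) , s≤s z≤n , toℕ<n j , collide zero (suc j) same
    fromCollision (suc i , suc j , s≤s i<j , same) =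
      ⊥-elim (^%-injective (s≤s z≤n) (s≤s i<j) (toℕ<n j) (collide (suc i) (suc j) same))

lowResidues : (n q : ℕ) .{{_ : NonZero q}} → Subset n
lowResidues n q = tabulate (λ x → toℕ x % q <ᵇ 2)

∈-lowResidues : ∀ {n q} .{{_ : NonZero q}} (x : Fin n) → toℕ x % q < 2 → x Subset.∈ lowResidues n q
∈-lowResidues x x%q<2 =
  lookup⇒[]= x _ (trans (lookup∘tabulate _ x) (Equivalence.to T-≡ (<⇒<ᵇ x%q<2)))

∣lowResidues∣≤ : ∀ n q .{{_ : NonZero q}} → q ∣ n → ∣ lowResidues n q ∣ ≤ 2 * n / q
∣lowResidues∣≤ .(m * q) q (divides m refl) = begin
  countBelow low (m * q)    ≡⟨ countBelow-periodic low q m (λ i → cong (_<ᵇ 2) (%-remove-+ˡ i ∣-refl)) ⟩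
  m * countBelow low q      ≡⟨ cong (m *_) (countBelow-cong q (λ i<q → cong (_<ᵇ 2) (m<n⇒m%n≡m i<q))) ⟩
  m * countBelow (_<ᵇ 2) q  ≤⟨ *-monoʳ-≤ m (countBelow-<ᵇ2 q) ⟩
  m * 2                     ≡⟨ *-comm m 2 ⟩
  2 * m                     ≡⟨ m*n/n≡m (2 * m) q ⟨
  2 * m * q / q             ≡⟨ cong (_/ q) (*-assoc 2 m q) ⟩
  2 * (m * q) / q           ∎
  where
  open ≤-Reasoning
  low : ℕ → Bool
  low i = i % q <ᵇ 2

∣p^k⇒≡1⊎p∣ : ∀ {p d} → Irreducible p → ∀ k → d ∣ p ^ k → d ≡ 1 ⊎ p ∣ d
∣p^k⇒≡1⊎p∣ irr zero d∣1 = inj₁ (∣1⇒≡1 d∣1)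
∣p^k⇒≡1⊎p∣ {p} {d} irr (suc k) d∣p^[1+k] with irr (gcd[m,n]∣n d p)
... | inj₁ gcd≡1 = ∣p^k⇒≡1⊎p∣ irr k (coprime-divisor (gcd≡1⇒coprime gcd≡1) d∣p^[1+k])
... | inj₂ gcd≡p = inj₂ (subst (_∣ d) gcd≡p (gcd[m,n]∣m d p))

¬p∣m⇒gcd[m,p^k]≡1 : ∀ {p m} → Irreducible p → ¬ p ∣ m → ∀ k → gcd m (p ^ k) ≡ 1
¬p∣m⇒gcd[m,p^k]≡1 {p} {m} irr p∤m k with ∣p^k⇒≡1⊎p∣ irr k (gcd[m,n]∣n m (p ^ k))
... | inj₁ gcd≡1 = gcd≡1
... | inj₂ p∣gcd = ⊥-elim (p∤m (∣-trans p∣gcd (gcd[m,n]∣m m (p ^ k))))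

¬p∣m+c : ∀ {p} → Prime p → ∀ m → ∃ λ c → c < 2 × ¬ p ∣ m + c
¬p∣m+c {p} pp m with p ∣? m + 0 | p ∣? m + 1
... | no p∤m   | _          = 0 , s≤s z≤n , p∤m
... | yes _    | no p∤m+1   = 1 , s≤s (s≤s z≤n) , p∤m+1
... | yes p∣m+0 | yes p∣m+1 = ⊥-elim (¬prime[1] (subst Prime (∣1⇒≡1 p∣1) pp))
  where
  p∣1 : p ∣ 1
  p∣1 = ∣m+n∣m⇒∣n p∣m+1 (subst (p ∣_) (+-identityʳ m) p∣m+0)

<⌈log₂⌉⇒2^< : ∀ {m n} → m < ⌈log₂ n ⌉ → 2 ^ m < n
<⌈log₂⌉⇒2^< {m} {n} m<log = ≰⇒> λ n≤2^m →
  <⇒≱ m<log (subst (⌈log₂ n ⌉ ≤_) (⌈log₂2^n⌉≡n m) (⌈log₂⌉-mono-≤ n≤2^m))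

2^≤⇒≤⌊log₂⌋ : ∀ {m n} → 2 ^ m ≤ n → m ≤ ⌊log₂ n ⌋
2^≤⇒≤⌊log₂⌋ {m} 2^m≤n = subst (_≤ _) (⌊log₂[2^n]⌋≡n m) (⌊log₂⌋-mono-≤ 2^m≤n)

partner : (n : ℕ) .{{_ : NonZero n}} → Fin n → ℕ → Fin n
partner n v t = fromℕ< (m%n<n ((n ∸ toℕ v) + (2 ^ t ∸ 1)) n)

partner-sum : ∀ n .{{_ : NonZero n}} v t → (toℕ v + toℕ (partner n v t)) % n ≡ (2 ^ t ∸ 1) % n
partner-sum n v t = begin
  (r + toℕ (partner n v t)) % n   ≡⟨ cong (λ u → (r + u) % n) (toℕ-fromℕ< (m%n<n ((n ∸ r) + X) n)) ⟩
  (r + ((n ∸ r) + X) % n) % n     ≡⟨ ModularArithmetic.%-congˡ-+ n r (m%n%n≡m%n ((n ∸ r) + X) n) ⟩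
  (r + ((n ∸ r) + X)) % n         ≡⟨ cong (_% n) (+-assoc r (n ∸ r) X) ⟨
  (r + (n ∸ r) + X) % n           ≡⟨ cong (λ m → (m + X) % n) (m+[n∸m]≡n (<⇒≤ (toℕ<n v))) ⟩
  (n + X) % n                     ≡⟨ %-remove-+ˡ X ∣-refl ⟩
  X % n                           ∎
  where
  open ≡-Reasoning
  r = toℕ v
  X = 2 ^ t ∸ 1

partner-residue : ∀ {n q} .{{_ : NonZero n}} .{{_ : NonZero q}} → q ∣ n → ∀ v t →
                  (suc (toℕ v) + toℕ (partner n v t)) % q ≡ 2 ^ t % q
partner-residue {n} {q} q∣n v t = begin
  (1 + (toℕ v + toℕ (partner n v t))) % q ≡⟨ %-congˡ-+ 1 (%-cong-∣ q∣n (partner-sum n v t)) ⟩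
  (1 + (2 ^ t ∸ 1)) % q                   ≡⟨ cong (_% q) (m+[n∸m]≡n (m^n>0 2 t)) ⟩
  2 ^ t % q                               ∎
  where
  open ≡-Reasoning
  open ModularArithmetic q

neighbour-in-lowResidues : ∀ {n q} .{{_ : NonZero n}} .{{_ : NonZero q}} → q ∣ n → (v : Fin n) →
  ∀ {c t} → c < 2 → 1 ≤ t → 2 ^ t ≤ n → (suc (toℕ v) + c) % q ≡ 2 ^ t % q →
  ∃ λ u → u Subset.∈ lowResidues n q × KGAdj n v u
neighbour-in-lowResidues {n} {q} q∣n v {c} {t} c<2 1≤t 2^t≤n v+1+c≡2^t =
  u , ∈-lowResidues u u%q<2 , t , 1≤t , 2^≤⇒≤⌊log₂⌋ 2^t≤n , partner-sum n v t
  where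
  open ModularArithmetic q
  u = partner n v t
  u%q≡c%q : toℕ u % q ≡ c % q
  u%q≡c%q = %-cancelˡ-+ (suc (toℕ v)) (trans (partner-residue q∣n v t) (sym v+1+c≡2^t))
  u%q<2 : toℕ u % q < 2
  u%q<2 = ≤-<-trans (≤-trans (≤-reflexive u%q≡c%q) (m%n≤m c q)) c<2

1<p^[1+k] : ∀ {p} → Prime p → ∀ k → 1 < p ^ suc k
1<p^[1+k] {p} pp k = <-≤-trans (nonTrivial⇒n>1 p {{prime⇒nonTrivial pp}})
                               (m≤m*n p (p ^ k) {{m^n≢0 p k {{prime⇒nonZero pp}}}})

lowResidues-dominating : ∀ n p k .{{_ : NonZero n}} .{{_ : NonZero (p ^ suc k)}} →
  Prime p → 2 ^ φ (p ^ suc k) < n → p ^ suc k ∣ n → PrimitiveRoot2 (p ^ suc k) →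
  IsDominatingKG n (lowResidues n (p ^ suc k))
lowResidues-dominating n p k pp 2^φ<n q∣n (2^φ≡1 , order) v
  with ¬p∣m+c pp (suc (toℕ v))
... | c , c<2 , p∤v+1+c
  with PrimitiveRoot.discreteLog (p ^ suc k) 2 (1<p^[1+k] pp k) 2^φ≡1 order
         ((suc (toℕ v) + c) % p ^ suc k) (m%n<n _ (p ^ suc k))
         (¬p∣m⇒gcd[m,p^k]≡1 (prime⇒irreducible pp) (p∤v+1+c ∘ ∣n∣m%n⇒∣m (m∣m*n (p ^ k))) (suc k))
... | t , 1≤t , t≤φ , v+1+c≡2^t =
  inj₂ (neighbour-in-lowResidues q∣n v c<2 1≤t (≤-trans (^-monoʳ-≤ 2 t≤φ) (<⇒≤ 2^φ<n)) v+1+c≡2^t)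

theorem8 : (n p k : ℕ) → .{{_ : NonZero n}} → .{{_ : NonZero (p ^ k)}} →
    6 ≤ n → 2 ∣ n → Prime p → ¬ (2 ∣ p) → 2 ≤ k →
    φ (p ^ k) < ⌈log₂ n ⌉ → (p ^ k) ∣ n → PrimitiveRoot2 (p ^ k) →
    γKG≤ n ((2 * n) / (p ^ k))
theorem8 n p zero _ _ _ _ ()
theorem8 n p (suc k) _ _ pp _ _ φ<⌈log₂n⌉ q∣n root =
  lowResidues n (p ^ suc k) ,
  lowResidues-dominating n p k pp (<⌈log₂⌉⇒2^< φ<⌈log₂n⌉) q∣n root ,
  ∣lowResidues∣≤ n (p ^ suc k) q∣n
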